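{- For every $d\ge1$, the sequence $A(d)$ is symmetric and unimodal; in particular its peak lies in the middle.
   Context: For $\sigma\in S_d$ (the symmetric group on $[d]$), $\mathrm{des}(\sigma)=\#\{i\in[d-1]:\sigma(i)>\sigma(i+1)\}$, and for $0\le i\le d-1$, $1\le j\le d$, $A(d,i,j)=\#\{\sigma\in S_d:\mathrm{des}(\sigma)=i,\ \sigma(1)=j\}$. Order the index pairs $(i,j)$ ($0\le i\le d-1$, $1\le j\le d$) totally by $(i,j)<(i',j')$ iff $i<i'$, or $i=i'$ and $j>j'$. $A(d)$ is the sequence of the $d^2$ numbers $A(d,i,j)$ listed in increasing order of $(i,j)$. A sequence $(s_0,\dots,s_N)$ is unimodal if $s_0\le\dots\le s_t\ge\dots\ge s_N$ for some $t$, and symmetric if $s_m=s_{N-m}$ for all $m$. -}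

module Defs where

open import Data.Nat using (ℕ; NonZero; zero; suc; _+_; _*_; _∸_; _≤_; _<_; _<ᵇ_)
open import Data.Nat.Properties using (_≟_)
open import Data.Nat.DivMod using (_/_; _%_)
open import Data.Fin as Fin using (Fin; toℕ)
open import Data.Fin.Properties as FinP using ()
open import Data.List as List using (List; []; _∷_; length; filter; concatMap; map; allFin)
open import Data.Vec as Vec using (Vec; []; _∷_; toList)
open import Data.List.Relation.Unary.Unique.Propositional using (Unique)
import Data.List.Relation.Unary.Unique.DecPropositional as UDec
open import Data.Product using (_×_; ∃-syntax)
open import Relation.Nullary using (Dec; _×-dec_)
open import Relation.Unary using (Decidable)

allWords : (d n : ℕ) → List (Vec (Fin d) n)
allWords d zero    = [] ∷ []
allWords d (suc n) = concatMap (λ a → map (a ∷_) (allWords d n)) (allFin d)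

-- A permutation σ ∈ S_d in one-line notation (σ(1), …, σ(d)), with values
-- shifted down by one: position k (0-based) holds σ(k+1) - 1.
-- A word of length d over Fin d is a permutation iff its entries are distinct.
IsPerm : {d : ℕ} → Vec (Fin d) d → Set
IsPerm v = Unique (toList v)

Sym : (d : ℕ) → List (Vec (Fin d) d)
Sym d = filter (λ v → UDec.unique? (FinP._≟_ {d}) (toList v)) (allWords d d)

desL : List ℕ → ℕ
desL []           = 0
desL (x ∷ [])     = 0
desL (x ∷ y ∷ xs) = (if y <ᵇ x then 1 else 0) + desL (y ∷ xs)
  where
  open import Data.Bool using (if_then_else_)

des : {d : ℕ} → Vec (Fin d) d → ℕ
des v = desL (List.map toℕ (toList v))

-- σ(1) as a value in [1, d]  (0 for the empty permutation, d = 0)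
first : {d : ℕ} → Vec (Fin d) d → ℕ
first {zero}  []      = 0
first {suc d} (x ∷ _) = suc (toℕ x)

A : (d i j : ℕ) → ℕ
A d i j = length (filter (λ v → (des v ≟ i) ×-dec (first v ≟ j)) (Sym d))

-- The sequence A(d): position m (0 ≤ m < d²) corresponds to the pair (i,j)
-- with i = m / d and j = d - (m mod d), i.e. pairs ordered by i increasing,
-- then j decreasing.
seqA : (d : ℕ) → .{{_ : NonZero d}} → ℕ → ℕ
seqA d m = A d (m / d) (d ∸ (m % d))

Symmetric : (N : ℕ) → (ℕ → ℕ) → Set
Symmetric N s = ∀ m → m ≤ N → s m ≡ s (N ∸ m)
  where open import Relation.Binary.PropositionalEquality using (_≡_)

Unimodal : (N : ℕ) → (ℕ → ℕ) → Set
Unimodal N s = ∃[ t ] (t ≤ N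
                     × (∀ m → m < t → s m ≤ s (suc m))
                     × (∀ m → t ≤ m → m < N → s (suc m) ≤ s m))

module Submission where

open import Defs
open import Data.Bool using (Bool; true; false; _∧_; if_then_else_)
open import Data.Bool.Properties using (∧-zeroʳ; ∧-identityʳ)
open import Data.Fin as Fin using (Fin; toℕ)
open import Data.Fin.Properties using (toℕ-injective)
open import Data.List as List using (List; []; _∷_; _++_; concatMap; tabulate; allFin; filter; length)
open import Data.List.Membership.Propositional using (_∉_)
open import Data.List.Relation.Unary.All as All using (All; []; _∷_)
open import Data.List.Relation.Unary.AllPairs using ([]; _∷_)
open import Data.List.Relation.Unary.Any using (here; there)
open import Data.List.Relation.Unary.Unique.Propositional using (Unique)
import Data.List.Relation.Unary.Unique.DecPropositional as UDec
open import Data.Nat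
open import Data.Nat.DivMod
open import Data.Nat.Divisibility using (n∣m*n)
open import Data.Nat.Properties
open import Data.Nat.Tactic.RingSolver using (solve-∀)
open import Data.List.Membership.DecPropositional _≟_ using (_∈?_; _∉?_)
open import Data.Product using (_×_; _,_; proj₁; proj₂)
open import Data.Sum using (inj₁; inj₂)
open import Data.Unit using (⊤; tt)
open import Data.Vec as Vec using (Vec; toList)
open import Function using (_∘_)
open import Function.Bundles using (_⇔_; mk⇔; module Equivalence)
open import Relation.Binary.PropositionalEquality
open import Relation.Nullary using (Dec; yes; no; does; ¬_; contradiction; _×-dec_)
open import Relation.Nullary.Decidable using (dec-true; dec-false; does-⇔)
open import Relation.Nullary.Reflects using (Reflects; ofʸ; ofⁿ; det; fromEquivalence)
open import Relation.Unary using (Decidable)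

-- Write A′ n p i for the number of permutations of n + 1 letters with first letter p
-- (counted from 0) and i descents.  Deleting the first letter gives a recursion for A′,
-- and complementing letters gives the symmetry A′ n p i = A′ n (n − p) (n − i), which is
-- the symmetry of A(d).  Inside a block of A(d) (fixed i) one passes from column p + 1
-- to column p, and the recursion gives
--   A′ (n+1) p i − A′ (n+1) (p+1) i = A′ n p i − A′ n p (i−1),
-- so A(d) rises as long as the columns of A′ n rise in i.  They do up to the middle row,
-- and at the middle of a table of even size n + 1 they rise once more past the middle
-- column; both facts are proved together by induction on n from the recursion and the
-- symmetry.  Consecutive blocks meet at equal values, A′ (n+1) 0 i = A′ (n+1) (n+1) (i+1),
-- and the second half of A(d) mirrors the first.

m+n≡o⇒o∸m≡n : ∀ m {n o} → m + n ≡ o → o ∸ m ≡ n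
m+n≡o⇒o∸m≡n m {n} refl = m+n∸m≡n m n

m+n≡o⇒m≤o : ∀ m {n o} → m + n ≡ o → m ≤ o
m+n≡o⇒m≤o m {n} refl = m≤m+n m n

m<n∸o⇒o+m<n : ∀ {m n} o → m < n ∸ o → o + m < n
m<n∸o⇒o+m<n {m} {n} o m<n∸o with o ≤? n
... | yes o≤n = subst (o + m <_) (m+[n∸m]≡n o≤n) (+-monoʳ-< o m<n∸o)
... | no  o≰n = contradiction (subst (m <_) (m≤n⇒m∸n≡0 (<⇒≤ (≰⇒> o≰n))) m<n∸o) n≮0

m+m≤n+n⇒m≤n : ∀ {m n} → m + m ≤ n + n → m ≤ n
m+m≤n+n⇒m≤n {m} {n} le with m ≤? n
... | yes m≤n = m≤n
... | no  m≰n = contradiction le (<⇒≱ (+-mono-< (≰⇒> m≰n) (≰⇒> m≰n)))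

n≤1+⌊n/2⌋+⌊n/2⌋ : ∀ n → n ≤ suc (⌊ n /2⌋ + ⌊ n /2⌋)
n≤1+⌊n/2⌋+⌊n/2⌋ zero          = z≤n
n≤1+⌊n/2⌋+⌊n/2⌋ (suc zero)    = s≤s z≤n
n≤1+⌊n/2⌋+⌊n/2⌋ (suc (suc n)) =
  s≤s (subst (suc n ≤_) (sym (+-suc (suc ⌊ n /2⌋) ⌊ n /2⌋)) (s≤s (n≤1+⌊n/2⌋+⌊n/2⌋ n)))

symmetric∧rising⇒unimodal : ∀ N (s : ℕ → ℕ) → Symmetric N s →
                            (∀ m → suc m + suc m ≤ N → s m ≤ s (suc m)) → Unimodal N s
symmetric∧rising⇒unimodal N s symmetric rising = t , ⌊n/2⌋≤n N , up , down
  where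
  t : ℕ
  t = ⌊ N /2⌋
  up : ∀ m → m < t → s m ≤ s (suc m)
  up m m<t = rising m (≤-trans (+-mono-≤ m<t m<t) 2t≤N)
    where
    2t≤N : t + t ≤ N
    2t≤N = subst (t + t ≤_) (⌊n/2⌋+⌈n/2⌉≡n N) (+-monoʳ-≤ t (⌊n/2⌋≤⌈n/2⌉ N))
  down : ∀ m → t ≤ m → m < N → s (suc m) ≤ s m
  down m t≤m m<N = descend (suc m′ + suc m′ ≤? N)
    where
    m′ : ℕ
    m′ = N ∸ suc m
    m′+1+m≡N : m′ + suc m ≡ N
    m′+1+m≡N = m∸n+n≡m m<N
    s[1+m]≡s[m′] : s (suc m) ≡ s m′
    s[1+m]≡s[m′] = symmetric (suc m) m<N
    s[m]≡s[1+m′] : s m ≡ s (suc m′)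
    s[m]≡s[1+m′] = trans (symmetric m (<⇒≤ m<N)) (cong s (+-∸-assoc 1 m<N))
    descend : Dec (suc m′ + suc m′ ≤ N) → s (suc m) ≤ s m
    descend (yes 2m′+2≤N) = subst₂ _≤_ (sym s[1+m]≡s[m′]) (sym s[m]≡s[1+m′]) (rising m′ 2m′+2≤N)
    descend (no  2m′+2≰N) = ≤-reflexive (trans s[1+m]≡s[m′] (cong s (≤-antisym m′≤m m≤m′)))
      where
      m≤m′ : m ≤ m′
      m≤m′ = ≤-pred (+-cancelˡ-≤ m′ (suc m) (suc m′)
               (≤-pred (subst (_< suc m′ + suc m′) (sym m′+1+m≡N) (≰⇒> 2m′+2≰N))))
      m′≤m : m′ ≤ m
      m′≤m = +-cancelʳ-≤ (suc m) m′ m (begin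
        m′ + suc m                ≡⟨ m′+1+m≡N ⟩
        N                         ≤⟨ n≤1+⌊n/2⌋+⌊n/2⌋ N ⟩
        suc (t + t)               ≤⟨ s≤s (+-mono-≤ t≤m t≤m) ⟩
        suc (m + m)               ≡⟨ +-suc m m ⟨
        m + suc m                 ∎)
        where open ≤-Reasoning

∑< : ℕ → (ℕ → ℕ) → ℕ
∑< zero    f = 0
∑< (suc n) f = ∑< n f + f n

-- The summand extends over one application only: ∑[ k < n ] a + b is (∑[ k < n ] a) + b.
syntax ∑< n (λ k → e) = ∑[ k < n ] e

∑<-cong : ∀ n {f g : ℕ → ℕ} → (∀ k → k < n → f k ≡ g k) → ∑< n f ≡ ∑< n g
∑<-cong zero    eq = refl
∑<-cong (suc n) eq = cong₂ _+_ (∑<-cong n (λ k k<n → eq k (m<n⇒m<1+n k<n))) (eq n ≤-refl)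

∑<-mono-≤ : ∀ n {f g : ℕ → ℕ} → (∀ k → k < n → f k ≤ g k) → ∑< n f ≤ ∑< n g
∑<-mono-≤ zero    le = z≤n
∑<-mono-≤ (suc n) le = +-mono-≤ (∑<-mono-≤ n (λ k k<n → le k (m<n⇒m<1+n k<n))) (le n ≤-refl)

∑<-zero : ∀ n {f : ℕ → ℕ} → (∀ k → k < n → f k ≡ 0) → ∑< n f ≡ 0
∑<-zero zero    eq = refl
∑<-zero (suc n) eq = cong₂ _+_ (∑<-zero n (λ k k<n → eq k (m<n⇒m<1+n k<n))) (eq n ≤-refl)

∑<-head : ∀ n (f : ℕ → ℕ) → ∑< (suc n) f ≡ f 0 + ∑[ k < n ] f (suc k)
∑<-head zero    f = +-comm 0 (f 0)
∑<-head (suc n) f = trans (cong (_+ f (suc n)) (∑<-head n f)) (+-assoc (f 0) _ _)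

∑<-+ : ∀ m n (f : ℕ → ℕ) → ∑< (m + n) f ≡ ∑< m f + ∑[ k < n ] f (m + k)
∑<-+ m zero    f = trans (cong (λ l → ∑< l f) (+-identityʳ m)) (sym (+-identityʳ _))
∑<-+ m (suc n) f = begin
  ∑< (m + suc n) f                                   ≡⟨ cong (λ l → ∑< l f) (+-suc m n) ⟩
  ∑< (m + n) f + f (m + n)                           ≡⟨ cong (_+ f (m + n)) (∑<-+ m n f) ⟩
  ∑< m f + ∑[ k < n ] f (m + k) + f (m + n)          ≡⟨ +-assoc (∑< m f) _ _ ⟩
  ∑< m f + (∑[ k < n ] f (m + k) + f (m + n))        ∎
  where open ≡-Reasoning

∑<-exchange : ∀ u q (f g : ℕ → ℕ) → u ≤ q → (∀ k → k < q → f k ≤ g k) →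
              ∑< q f + ∑< u g ≤ ∑< q g + ∑< u f
∑<-exchange u q f g u≤q f≤g = begin
  ∑< q f + ∑< u g                                  ≡⟨ cong (λ l → ∑< l f + ∑< u g) q≡u+r ⟩
  ∑< (u + r) f + ∑< u g                            ≡⟨ cong (_+ ∑< u g) (∑<-+ u r f) ⟩
  ∑< u f + ∑[ k < r ] f (u + k) + ∑< u g           ≤⟨ +-monoˡ-≤ (∑< u g) (+-monoʳ-≤ (∑< u f) tail≤) ⟩
  ∑< u f + ∑[ k < r ] g (u + k) + ∑< u g           ≡⟨ rearrange (∑< u f) _ (∑< u g) ⟩
  ∑< u g + ∑[ k < r ] g (u + k) + ∑< u f           ≡⟨ cong (_+ ∑< u f) (∑<-+ u r g) ⟨
  ∑< (u + r) g + ∑< u f                            ≡⟨ cong (λ l → ∑< l g + ∑< u f) q≡u+r ⟨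
  ∑< q g + ∑< u f                                  ∎
  where
  open ≤-Reasoning
  r : ℕ
  r = q ∸ u
  q≡u+r : q ≡ u + r
  q≡u+r = sym (m+[n∸m]≡n u≤q)
  tail≤ : ∑[ k < r ] f (u + k) ≤ ∑[ k < r ] g (u + k)
  tail≤ = ∑<-mono-≤ r (λ k k<r → f≤g (u + k) (subst (u + k <_) (sym q≡u+r) (+-monoʳ-< u k<r)))
  rearrange : ∀ a b c → a + b + c ≡ c + b + a
  rearrange = solve-∀

∑<-reverse : ∀ n (f : ℕ → ℕ) → ∑< n f ≡ ∑[ k < n ] f (n ∸ suc k)
∑<-reverse zero    f = refl
∑<-reverse (suc n) f = begin
  ∑< n f + f n                                ≡⟨ cong (_+ f n) (∑<-reverse n f) ⟩
  ∑[ k < n ] f (n ∸ suc k) + f n              ≡⟨ +-comm _ (f n) ⟩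
  f n + ∑[ k < n ] f (n ∸ suc k)              ≡⟨ ∑<-head n (λ k → f (suc n ∸ suc k)) ⟨
  ∑[ k < suc n ] f (suc n ∸ suc k)            ∎
  where open ≡-Reasoning

∑<-reflect : ∀ m p p′ u (f g : ℕ → ℕ) → p + u + p′ ≡ suc m →
             (∀ k → k ≤ m → f k ≡ g (m ∸ k)) →
             ∑[ k < u ] f (p + k) ≡ ∑[ k < u ] g (p′ + k)
∑<-reflect m p p′ u f g window f≡g = trans (∑<-reverse u _) (∑<-cong u mirror)
  where
  mirror : ∀ k → k < u → f (p + (u ∸ suc k)) ≡ g (p′ + k)
  mirror k k<u = trans (f≡g (p + e) (m+n≡o⇒m≤o (p + e) sum≡m))
                       (cong g (m+n≡o⇒o∸m≡n (p + e) sum≡m))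
    where
    e : ℕ
    e = u ∸ suc k
    sum≡m : p + e + (p′ + k) ≡ m
    sum≡m = suc-injective (begin
      suc (p + e + (p′ + k))    ≡⟨ rearrange p e p′ k ⟩
      p + (suc k + e) + p′      ≡⟨ cong (λ l → p + l + p′) (m+[n∸m]≡n k<u) ⟩
      p + u + p′                ≡⟨ window ⟩
      suc m                     ∎)
      where
      open ≡-Reasoning
      rearrange : ∀ p e p′ k → suc (p + e + (p′ + k)) ≡ p + (suc k + e) + p′
      rearrange = solve-∀

delay : (ℕ → ℕ) → ℕ → ℕ
delay g zero    = 0
delay g (suc i) = g i

delay-cong : ∀ {g h : ℕ → ℕ} i → (∀ j → g j ≡ h j) → delay g i ≡ delay h i
delay-cong zero    eq = refl
delay-cong (suc i) eq = eq i

-- A′ n p i counts the permutations of {0,…,n} with first letter p and i descents, that is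
-- A (suc n) i (suc p) (see A≡A′).  Deleting the first letter p leaves a permutation of n
-- letters whose first letter has rank k among them, and the deleted position is a descent
-- exactly when k < p.  Entries with p > n are junk (A′ 0 p 0 = 1), hence the hypotheses
-- p ≤ n below.
A′ : ℕ → ℕ → ℕ → ℕ
A′ zero    p zero    = 1
A′ zero    p (suc i) = 0
A′ (suc n) p i = ∑[ k < p ] delay (A′ n k) i + ∑[ k < suc n ∸ p ] A′ n (p + k) i

A′-vanishing : ∀ n p i → n < i → A′ n p i ≡ 0
A′-vanishing zero    p (suc i) _         = refl
A′-vanishing (suc n) p (suc i) (s≤s n<i) = cong₂ _+_
  (∑<-zero p (λ k _ → A′-vanishing n k i n<i))
  (∑<-zero (suc n ∸ p) (λ k _ → A′-vanishing n (p + k) (suc i) (m<n⇒m<1+n n<i)))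

A′-step : ∀ n p i → p ≤ n →
          A′ (suc n) p i + delay (A′ n p) i ≡ A′ (suc n) (suc p) i + A′ n p i
A′-step n p i p≤n = begin
  (L + R) + D               ≡⟨ cong (λ x → L + x + D) split ⟩
  (L + (A′ n p i + R′)) + D ≡⟨ rearrange L (A′ n p i) R′ D ⟩
  (L + D + R′) + A′ n p i   ∎
  where
  open ≡-Reasoning
  L D R R′ : ℕ
  L  = ∑[ k < p ] delay (A′ n k) i
  D  = delay (A′ n p) i
  R  = ∑[ k < suc n ∸ p ] A′ n (p + k) i
  R′ = ∑[ k < n ∸ p ] A′ n (suc p + k) i
  split : R ≡ A′ n p i + R′
  split = begin
    R                                          ≡⟨ cong (λ l → ∑[ k < l ] A′ n (p + k) i) (+-∸-assoc 1 p≤n) ⟩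
    ∑[ k < suc (n ∸ p) ] A′ n (p + k) i        ≡⟨ ∑<-head (n ∸ p) _ ⟩
    A′ n (p + 0) i + ∑[ k < n ∸ p ] A′ n (p + suc k) i
      ≡⟨ cong₂ _+_ (cong (λ x → A′ n x i) (+-identityʳ p))
                   (∑<-cong (n ∸ p) (λ k _ → cong (λ x → A′ n x i) (+-suc p k))) ⟩
    A′ n p i + R′                              ∎
  rearrange : ∀ l a r d → (l + (a + r)) + d ≡ (l + d + r) + a
  rearrange = solve-∀

A′-row-descends : ∀ n p i → p ≤ n → delay (A′ n p) i ≤ A′ n p i →
                  A′ (suc n) (suc p) i ≤ A′ (suc n) p i
A′-row-descends n p i p≤n column-rises = +-cancelʳ-≤ (A′ n p i) _ _ (begin
  A′ (suc n) (suc p) i + A′ n p i       ≡⟨ A′-step n p i p≤n ⟨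
  A′ (suc n) p i + delay (A′ n p) i     ≤⟨ +-monoʳ-≤ (A′ (suc n) p i) column-rises ⟩
  A′ (suc n) p i + A′ n p i             ∎)
  where open ≤-Reasoning

A′-first≡last : ∀ n i → A′ (suc n) 0 i ≡ A′ (suc n) (suc n) (suc i)
A′-first≡last n i = sym (trans
  (cong (λ l → ∑[ k < suc n ] A′ n k i + ∑[ k < l ] A′ n (suc n + k) (suc i)) (n∸n≡0 n))
  (+-identityʳ _))

mutual
  A′-sym : ∀ n p i → p ≤ n → i ≤ n → A′ n p i ≡ A′ n (n ∸ p) (n ∸ i)
  A′-sym zero    zero zero _ _ = refl
  A′-sym (suc n) p i p≤ i≤ = begin
    ∑[ k < p ] delay (A′ n k) i + ∑[ k < q ] A′ n (p + k) i
      ≡⟨ cong₂ _+_ (∑<-reflect n 0 q p (λ k → delay (A′ n k) i) (λ k → A′ n k j)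
                                 (m+[n∸m]≡n p≤) delayed≡mirror)
                   (∑<-reflect n p 0 q (λ k → A′ n k i) (λ k → delay (A′ n k) j)
                                 (trans (+-identityʳ _) (m+[n∸m]≡n p≤)) (λ k k≤n → A′-sym-delay n k i k≤n i≤)) ⟩
    ∑[ k < p ] A′ n (q + k) j + ∑[ k < q ] delay (A′ n k) j
      ≡⟨ +-comm (∑[ k < p ] A′ n (q + k) j) _ ⟩
    ∑[ k < q ] delay (A′ n k) j + ∑[ k < p ] A′ n (q + k) j
      ≡⟨ cong (λ l → ∑[ k < q ] delay (A′ n k) j + ∑[ k < l ] A′ n (q + k) j) (m∸[m∸n]≡n p≤) ⟨
    A′ (suc n) q j ∎
    where
    open ≡-Reasoning
    q j : ℕ
    q = suc n ∸ p
    j = suc n ∸ i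
    delayed≡mirror : ∀ k → k ≤ n → delay (A′ n k) i ≡ A′ n (n ∸ k) j
    delayed≡mirror k k≤n = sym (begin
      A′ n (n ∸ k) j
        ≡⟨ A′-sym-delay n (n ∸ k) j (m∸n≤m n k) (m∸n≤m (suc n) i) ⟩
      delay (A′ n (n ∸ (n ∸ k))) (suc n ∸ j)
        ≡⟨ cong₂ (λ x y → delay (A′ n x) y) (m∸[m∸n]≡n k≤n) (m∸[m∸n]≡n i≤) ⟩
      delay (A′ n k) i ∎)

  A′-sym-delay : ∀ n p i → p ≤ n → i ≤ suc n → A′ n p i ≡ delay (A′ n (n ∸ p)) (suc n ∸ i)
  A′-sym-delay n p i p≤n i≤ with m≤n⇒m<n∨m≡n i≤
  ... | inj₂ refl = trans (A′-vanishing n p (suc n) ≤-refl) (cong (delay _) (sym (n∸n≡0 (suc n))))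
  ... | inj₁ (s≤s i≤n) =
    trans (A′-sym n p i p≤n i≤n) (cong (delay (A′ n (n ∸ p))) (sym (+-∸-assoc 1 i≤n)))

RisesBelowMiddle : ℕ → Set
RisesBelowMiddle m = ∀ q i → q ≤ m → i + i ≤ m → delay (A′ m q) i ≤ A′ m q i

RisesAcrossMiddle : ℕ → Set
RisesAcrossMiddle m = ∀ q i → m ≡ suc (i + i) → suc i ≤ q → q ≤ m → A′ m q i ≤ A′ m q (suc i)

A′-middleRows-window : ∀ m j p L → m ≡ suc (j + j) → p + L + p ≡ suc m →
                       ∑[ k < L ] A′ m (p + k) j ≡ ∑[ k < L ] A′ m (p + k) (suc j)
A′-middleRows-window m j p L m≡ window =
  ∑<-reflect m p p L (λ k → A′ m k j) (λ k → A′ m k (suc j)) window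
    (λ k k≤m → trans (A′-sym m k j k≤m j≤m) (cong (A′ m (m ∸ k)) m∸j≡1+j))
  where
  j+1+j≡m : j + suc j ≡ m
  j+1+j≡m = trans (+-suc j j) (sym m≡)
  j≤m : j ≤ m
  j≤m = m+n≡o⇒m≤o j j+1+j≡m
  m∸j≡1+j : m ∸ j ≡ suc j
  m∸j≡1+j = m+n≡o⇒o∸m≡n j j+1+j≡m

-- For q ≤ j the columns q … m split into a window symmetric about m / 2, where the two
-- rows have equal sums, and q columns beyond it, which all lie past the middle.
columnsFrom-rise : ∀ m j → m ≡ suc (j + j) → RisesAcrossMiddle m → ∀ q →
                   ∑[ k < suc m ∸ q ] A′ m (q + k) j ≤ ∑[ k < suc m ∸ q ] A′ m (q + k) (suc j)
columnsFrom-rise m j m≡ across q with suc j ≤? q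
... | yes j<q = ∑<-mono-≤ (suc m ∸ q) (λ k k< →
                  across (q + k) j m≡ (≤-trans j<q (m≤m+n q k)) (≤-pred (m<n∸o⇒o+m<n q k<)))
... | no  j≮q = subst (λ l → ∑[ k < l ] A′ m (q + k) j ≤ ∑[ k < l ] A′ m (q + k) (suc j))
                  (sym width) (begin
  ∑[ k < L + q ] A′ m (q + k) j
    ≡⟨ ∑<-+ L q _ ⟩
  ∑[ k < L ] A′ m (q + k) j + ∑[ k < q ] A′ m (q + (L + k)) j
    ≤⟨ +-mono-≤ (≤-reflexive (A′-middleRows-window m j q L m≡ window)) upper ⟩
  ∑[ k < L ] A′ m (q + k) (suc j) + ∑[ k < q ] A′ m (q + (L + k)) (suc j)
    ≡⟨ ∑<-+ L q _ ⟨
  ∑[ k < L + q ] A′ m (q + k) (suc j) ∎)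
  where
  open ≤-Reasoning
  q≤j : q ≤ j
  q≤j = ≤-pred (≰⇒> j≮q)
  L : ℕ
  L = suc m ∸ (q + q)
  window : q + L + q ≡ suc m
  window = begin-equality
    q + L + q     ≡⟨ rearrange q L ⟩
    L + (q + q)   ≡⟨ m∸n+n≡m 2q≤1+m ⟩
    suc m         ∎
    where
    rearrange : ∀ q L → q + L + q ≡ L + (q + q)
    rearrange = solve-∀
    2q≤1+m : q + q ≤ suc m
    2q≤1+m = ≤-trans (+-mono-≤ q≤j q≤j) (subst (j + j ≤_) (cong suc (sym m≡)) (m≤n⇒m≤1+n (n≤1+n _)))
  width : suc m ∸ q ≡ L + q
  width = m+n≡o⇒o∸m≡n q (trans (sym (+-assoc q L q)) window)
  upper : ∑[ k < q ] A′ m (q + (L + k)) j ≤ ∑[ k < q ] A′ m (q + (L + k)) (suc j)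
  upper = ∑<-mono-≤ q (λ k k<q → across (q + (L + k)) j m≡ (past-middle k) (within k k<q))
    where
    past-middle : ∀ k → suc j ≤ q + (L + k)
    past-middle k = ≤-trans (+-cancelʳ-≤ q (suc j) (q + L) (begin
      suc j + q        ≤⟨ +-monoʳ-≤ (suc j) q≤j ⟩
      suc j + j        ≤⟨ n≤1+n _ ⟩
      suc (suc j + j)  ≡⟨ cong suc m≡ ⟨
      suc m            ≡⟨ window ⟨
      q + L + q        ∎)) (subst (q + L ≤_) (+-assoc q L k) (m≤m+n (q + L) k))
    within : ∀ k → k < q → q + (L + k) ≤ m
    within k k<q = ≤-pred (begin-strict
      q + (L + k)      ≡⟨ +-assoc q L k ⟨
      q + L + k        <⟨ +-monoʳ-< (q + L) k<q ⟩
      q + L + q        ≡⟨ window ⟩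
      suc m            ∎)

risesBelowMiddle-suc : ∀ m → RisesBelowMiddle m → RisesAcrossMiddle m → RisesBelowMiddle (suc m)
risesBelowMiddle-suc m below across q zero    q≤ _   = z≤n
risesBelowMiddle-suc m below across q (suc j) q≤ 2j≤ = +-mono-≤ firstColumns laterColumns
  where
  j+1+j≤m : j + suc j ≤ m
  j+1+j≤m = ≤-pred 2j≤
  firstColumns : ∑[ k < q ] delay (A′ m k) j ≤ ∑[ k < q ] A′ m k j
  firstColumns = ∑<-mono-≤ q (λ k k<q →
    below k j (≤-pred (≤-trans k<q q≤)) (≤-trans (+-monoʳ-≤ j (n≤1+n j)) j+1+j≤m))
  laterColumns : ∑[ k < suc m ∸ q ] A′ m (q + k) j ≤ ∑[ k < suc m ∸ q ] A′ m (q + k) (suc j)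
  laterColumns with suc j + suc j ≤? m
  ... | yes 2j+2≤m = ∑<-mono-≤ (suc m ∸ q) (λ k k< →
                        below (q + k) (suc j) (≤-pred (m<n∸o⇒o+m<n q k<)) 2j+2≤m)
  ... | no  2j+2≰m = columnsFrom-rise m j m≡ across q
    where
    m≡ : m ≡ suc (j + j)
    m≡ = trans (sym (≤-antisym j+1+j≤m (≤-pred (≰⇒> 2j+2≰m)))) (+-suc j j)

-- With m = 2i, reflection turns the last u columns of rows i and i + 1 into the first u
-- columns of rows i and i ∸ 1, and u ≤ q.
risesAcrossMiddle-suc : ∀ m → RisesBelowMiddle m → RisesAcrossMiddle (suc m)
risesAcrossMiddle-suc m below q i 1+m≡ i<q q≤ = begin
  ∑[ k < q ] delay (A′ m k) i + ∑[ k < u ] A′ m (q + k) i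
    ≡⟨ cong (∑[ k < q ] delay (A′ m k) i +_)
            (∑<-reflect m q 0 u (λ k → A′ m k i) (λ k → A′ m k i) window row-i) ⟩
  ∑[ k < q ] delay (A′ m k) i + ∑[ k < u ] A′ m k i
    ≤⟨ ∑<-exchange u q _ _ u≤q (λ k k<q → below k i (≤-pred (≤-trans k<q q≤)) (≤-reflexive (sym m≡))) ⟩
  ∑[ k < q ] A′ m k i + ∑[ k < u ] delay (A′ m k) i
    ≡⟨ cong (∑[ k < q ] A′ m k i +_)
            (∑<-reflect m q 0 u (λ k → A′ m k (suc i)) (λ k → delay (A′ m k) i) window row-1+i) ⟨
  ∑[ k < q ] A′ m k i + ∑[ k < u ] A′ m (q + k) (suc i) ∎
  where
  open ≤-Reasoning
  m≡ : m ≡ i + i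
  m≡ = suc-injective 1+m≡
  u : ℕ
  u = suc m ∸ q
  window : q + u + 0 ≡ suc m
  window = trans (+-identityʳ _) (m+[n∸m]≡n q≤)
  m∸i≡i : m ∸ i ≡ i
  m∸i≡i = m+n≡o⇒o∸m≡n i (sym m≡)
  i≤m : i ≤ m
  i≤m = m+n≡o⇒m≤o i (sym m≡)
  row-i : ∀ k → k ≤ m → A′ m k i ≡ A′ m (m ∸ k) i
  row-i k k≤m = trans (A′-sym m k i k≤m i≤m) (cong (A′ m (m ∸ k)) m∸i≡i)
  row-1+i : ∀ k → k ≤ m → A′ m k (suc i) ≡ delay (A′ m (m ∸ k)) i
  row-1+i k k≤m =
    trans (A′-sym-delay m k (suc i) k≤m (s≤s i≤m)) (cong (delay (A′ m (m ∸ k))) m∸i≡i)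
  u≤q : u ≤ q
  u≤q = begin
    suc m ∸ q        ≤⟨ ∸-monoʳ-≤ (suc m) i<q ⟩
    m ∸ i            ≡⟨ m∸i≡i ⟩
    i                ≤⟨ n≤1+n i ⟩
    suc i            ≤⟨ i<q ⟩
    q                ∎

columns-rise : ∀ m → RisesBelowMiddle m × RisesAcrossMiddle m
columns-rise zero    = below₀ , λ _ _ ()
  where
  below₀ : RisesBelowMiddle 0
  below₀ q zero _ _ = z≤n
columns-rise (suc m) = risesBelowMiddle-suc m below across , risesAcrossMiddle-suc m below
  where
  below : RisesBelowMiddle m
  below = proj₁ (columns-rise m)
  across : RisesAcrossMiddle m
  across = proj₂ (columns-rise m)

A′-column-rises : ∀ m q i → q ≤ m → i + i ≤ suc m → (i + i ≡ suc m → i ≤ q) →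
                  delay (A′ m q) i ≤ A′ m q i
A′-column-rises m q zero    _   _   _      = z≤n
A′-column-rises m q (suc j) q≤m 2i≤ middle with suc j + suc j ≤? m
... | yes 2i≤m = proj₁ (columns-rise m) q (suc j) q≤m 2i≤m
... | no  2i≰m = proj₂ (columns-rise m) q j m≡ (middle 2i≡) q≤m
  where
  2i≡ : suc j + suc j ≡ suc m
  2i≡ = ≤-antisym 2i≤ (≰⇒> 2i≰m)
  m≡ : m ≡ suc (j + j)
  m≡ = trans (sym (suc-injective 2i≡)) (+-suc j j)

𝟙 : Bool → ℕ
𝟙 b = if b then 1 else 0

∑∈ : {A : Set} → List A → (A → ℕ) → ℕ
∑∈ []       f = 0
∑∈ (x ∷ xs) f = f x + ∑∈ xs f

syntax ∑∈ xs (λ x → e) = ∑[ x ∈ xs ] e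

∑∈-cong : ∀ {A : Set} (xs : List A) {f g : A → ℕ} → (∀ x → f x ≡ g x) → ∑∈ xs f ≡ ∑∈ xs g
∑∈-cong []       eq = refl
∑∈-cong (x ∷ xs) eq = cong₂ _+_ (eq x) (∑∈-cong xs eq)

∑∈-zero : ∀ {A : Set} (xs : List A) {f : A → ℕ} → (∀ x → f x ≡ 0) → ∑∈ xs f ≡ 0
∑∈-zero []       eq = refl
∑∈-zero (x ∷ xs) eq = cong₂ _+_ (eq x) (∑∈-zero xs eq)

∑∈-++ : ∀ {A : Set} (xs ys : List A) (f : A → ℕ) → ∑∈ (xs ++ ys) f ≡ ∑∈ xs f + ∑∈ ys f
∑∈-++ []       ys f = refl
∑∈-++ (x ∷ xs) ys f = trans (cong (f x +_) (∑∈-++ xs ys f)) (sym (+-assoc (f x) _ _))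

∑∈-concatMap : ∀ {A B : Set} (g : A → List B) (xs : List A) (f : B → ℕ) →
               ∑∈ (concatMap g xs) f ≡ ∑[ x ∈ xs ] ∑∈ (g x) f
∑∈-concatMap g []       f = refl
∑∈-concatMap g (x ∷ xs) f =
  trans (∑∈-++ (g x) (concatMap g xs) f) (cong (∑∈ (g x) f +_) (∑∈-concatMap g xs f))

∑∈-map : ∀ {A B : Set} (h : A → B) (xs : List A) (f : B → ℕ) → ∑∈ (List.map h xs) f ≡ ∑∈ xs (f ∘ h)
∑∈-map h []       f = refl
∑∈-map h (x ∷ xs) f = cong (f (h x) +_) (∑∈-map h xs f)

∑∈-tabulate : ∀ {A : Set} n (h : Fin n → A) (f : A → ℕ) (g : ℕ → ℕ) →
              (∀ k → f (h k) ≡ g (toℕ k)) → ∑∈ (tabulate h) f ≡ ∑< n g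
∑∈-tabulate zero    h f g eq = refl
∑∈-tabulate (suc n) h f g eq = trans
  (cong₂ _+_ (eq Fin.zero) (∑∈-tabulate n (h ∘ Fin.suc) f (g ∘ suc) (eq ∘ Fin.suc)))
  (sym (∑<-head n g))

∑∈-allWords-suc : ∀ d n (f : Vec (Fin d) (suc n) → ℕ) (g : ℕ → ℕ) →
                 (∀ b → ∑[ w ∈ allWords d n ] f (b Vec.∷ w) ≡ g (toℕ b)) →
                 ∑∈ (allWords d (suc n)) f ≡ ∑< d g
∑∈-allWords-suc d n f g eq = begin
  ∑∈ (allWords d (suc n)) f
    ≡⟨ ∑∈-concatMap _ (allFin d) f ⟩
  ∑[ b ∈ allFin d ] ∑∈ (List.map (b Vec.∷_) (allWords d n)) f
    ≡⟨ ∑∈-tabulate d (λ b → b) _ g (λ b → trans (∑∈-map (b Vec.∷_) (allWords d n) f) (eq b)) ⟩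
  ∑< d g ∎
  where open ≡-Reasoning

length-filter-filter : ∀ {A : Set} {P Q : A → Set} (P? : Decidable P) (Q? : Decidable Q) xs →
                       length (filter P? (filter Q? xs)) ≡ ∑[ x ∈ xs ] 𝟙 (does (Q? x) ∧ does (P? x))
length-filter-filter P? Q? [] = refl
length-filter-filter P? Q? (x ∷ xs) with does (Q? x)
... | false = length-filter-filter P? Q? xs
... | true with does (P? x)
...   | false = length-filter-filter P? Q? xs
...   | true  = cong suc (length-filter-filter P? Q? xs)

<ᵇ-true : ∀ {m n} → m < n → (m <ᵇ n) ≡ true
<ᵇ-true {m} {n} m<n = det (<ᵇ-reflects-< m n) (ofʸ m<n)

<ᵇ-false : ∀ {m n} → ¬ m < n → (m <ᵇ n) ≡ false
<ᵇ-false {m} {n} m≮n = det (<ᵇ-reflects-< m n) (ofⁿ m≮n)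

<ᵇ-suc : ∀ {m n} → m ≢ n → (m <ᵇ suc n) ≡ (m <ᵇ n)
<ᵇ-suc {zero}  {zero}  m≢n = contradiction refl m≢n
<ᵇ-suc {zero}  {suc n} m≢n = refl
<ᵇ-suc {suc m} {zero}  m≢n = refl
<ᵇ-suc {suc m} {suc n} m≢n = <ᵇ-suc (m≢n ∘ cong suc)

≡ᵇ-reflects-≡ : ∀ m n → Reflects (m ≡ n) (m ≡ᵇ n)
≡ᵇ-reflects-≡ m n = fromEquivalence (≡ᵇ⇒≡ m n) (≡⇒≡ᵇ m n)

≡ᵇ-refl : ∀ n → (n ≡ᵇ n) ≡ true
≡ᵇ-refl n = det (≡ᵇ-reflects-≡ n n) (ofʸ refl)

≡ᵇ-false : ∀ {m n} → m ≢ n → (m ≡ᵇ n) ≡ false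
≡ᵇ-false {m} {n} m≢n = det (≡ᵇ-reflects-≡ m n) (ofⁿ m≢n)

∑<-indicator : ∀ q (f : ℕ → ℕ) c → q < c → ∑[ x < c ] (𝟙 (x ≡ᵇ q) * f x) ≡ f q
∑<-indicator q f (suc c) q<1+c with m≤n⇒m<n∨m≡n (≤-pred q<1+c)
... | inj₁ q<c = begin
  ∑[ x < c ] (𝟙 (x ≡ᵇ q) * f x) + 𝟙 (c ≡ᵇ q) * f c   ≡⟨ cong (λ b → ∑[ x < c ] (𝟙 (x ≡ᵇ q) * f x) + 𝟙 b * f c)
                                                            (≡ᵇ-false (>⇒≢ q<c)) ⟩
  ∑[ x < c ] (𝟙 (x ≡ᵇ q) * f x) + 0                  ≡⟨ +-identityʳ _ ⟩
  ∑[ x < c ] (𝟙 (x ≡ᵇ q) * f x)                      ≡⟨ ∑<-indicator q f c q<c ⟩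
  f q                                                ∎
  where open ≡-Reasoning
... | inj₂ refl = begin
  ∑[ x < q ] (𝟙 (x ≡ᵇ q) * f x) + 𝟙 (q ≡ᵇ q) * f q
    ≡⟨ cong₂ _+_ (∑<-zero q (λ x x<q → cong (λ b → 𝟙 b * f x) (≡ᵇ-false (<⇒≢ x<q))))
                 (cong (λ b → 𝟙 b * f q) (≡ᵇ-refl q)) ⟩
  0 + 1 * f q                                        ≡⟨ *-identityˡ (f q) ⟩
  f q                                                ∎
  where open ≡-Reasoning

-- Fresh is defined letter by letter so that freshness of b ∷ L unfolds to freshness of L
-- after b has joined U; Fresh⇔avoiding×Unique describes it directly.
Fresh : ∀ {d} → List ℕ → List (Fin d) → Set
Fresh U []      = ⊤
Fresh U (b ∷ L) = toℕ b ∉ U × Fresh (toℕ b ∷ U) L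

fresh? : ∀ {d} U (L : List (Fin d)) → Dec (Fresh U L)
fresh? U []      = yes tt
fresh? U (b ∷ L) = toℕ b ∉? U ×-dec fresh? (toℕ b ∷ U) L

Fresh⇔avoiding×Unique : ∀ {d} U (L : List (Fin d)) →
                        Fresh U L ⇔ (All (λ c → toℕ c ∉ U) L × Unique L)
Fresh⇔avoiding×Unique U L = mk⇔ (to U L) (from U L)
  where
  to : ∀ U L → Fresh U L → All (λ c → toℕ c ∉ U) L × Unique L
  to U []      _           = [] , []
  to U (b ∷ L) (b∉U , fresh) = extend (to (toℕ b ∷ U) L fresh)
    where
    extend : All (λ c → toℕ c ∉ toℕ b ∷ U) L × Unique L →
             All (λ c → toℕ c ∉ U) (b ∷ L) × Unique (b ∷ L)
    extend (avoid , unique) = (b∉U ∷ All.map (λ c∉ → c∉ ∘ there) avoid)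
                            , (All.map (λ c∉ b≡c → c∉ (here (cong toℕ (sym b≡c)))) avoid ∷ unique)
  from : ∀ U L → All (λ c → toℕ c ∉ U) L × Unique L → Fresh U L
  from U []      _ = tt
  from U (b ∷ L) (b∉U ∷ avoid , b≢L ∷ unique) =
    b∉U , from (toℕ b ∷ U) L (All.zipWith avoid-∷ (b≢L , avoid) , unique)
    where
    avoid-∷ : ∀ {c} → b ≢ c × toℕ c ∉ U → toℕ c ∉ toℕ b ∷ U
    avoid-∷ (b≢c , c∉U) (here c≡b)  = b≢c (sym (toℕ-injective c≡b))
    avoid-∷ (b≢c , c∉U) (there c∈U) = c∉U c∈U

does-unique≡fresh : ∀ {d} (b : Fin d) L →
                    does (UDec.unique? Fin._≟_ (b ∷ L)) ≡ does (fresh? (toℕ b ∷ []) L)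
does-unique≡fresh b L = does-⇔ (mk⇔ to from) (UDec.unique? Fin._≟_ (b ∷ L)) (fresh? (toℕ b ∷ []) L)
  where
  open Equivalence (Fresh⇔avoiding×Unique (toℕ b ∷ []) L) renaming (to to toF; from to fromF)
  to : Unique (b ∷ L) → Fresh (toℕ b ∷ []) L
  to (b≢L ∷ unique) =
    fromF (All.map (λ b≢c → λ { (here c≡b) → b≢c (sym (toℕ-injective c≡b)) }) b≢L , unique)
  from : Fresh (toℕ b ∷ []) L → Unique (b ∷ L)
  from fresh =
    All.map (λ c∉ b≡c → c∉ (here (cong toℕ (sym b≡c)))) (proj₁ (toF fresh)) ∷ proj₂ (toF fresh)

∉-∷⇔∉ : ∀ {x y : ℕ} U → x ≢ y → x ∉ y ∷ U ⇔ x ∉ U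
∉-∷⇔∉ U x≢y = mk⇔ (λ x∉ → x∉ ∘ there) (λ { x∉ (here x≡y) → x≢y x≡y ; x∉ (there x∈U) → x∉ x∈U })

rank : List ℕ → ℕ → ℕ
rank U c = ∑[ x < c ] 𝟙 (does (x ∉? U))

rank-∷ : ∀ U x → x ∉ U → ∀ c → rank U c ≡ rank (x ∷ U) c + 𝟙 (x <ᵇ c)
rank-∷ U x x∉U zero    = refl
rank-∷ U x x∉U (suc c) with c ≟ x
... | yes refl = begin
  rank U c + 𝟙 (does (c ∉? U))
    ≡⟨ cong₂ _+_ (rank-∷ U c x∉U c) (cong 𝟙 (dec-true (c ∉? U) x∉U)) ⟩
  rank (c ∷ U) c + 𝟙 (c <ᵇ c) + 1
    ≡⟨ cong (λ b → rank (c ∷ U) c + 𝟙 b + 1) (<ᵇ-false (n≮n c)) ⟩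
  rank (c ∷ U) c + 0 + 1
    ≡⟨ cong₂ (λ a b → rank (c ∷ U) c + 𝟙 a + 𝟙 b)
             (dec-false (c ∉? c ∷ U) (λ c∉ → c∉ (here refl))) (<ᵇ-true (n<1+n c)) ⟨
  rank (c ∷ U) c + 𝟙 (does (c ∉? c ∷ U)) + 𝟙 (c <ᵇ suc c) ∎
  where open ≡-Reasoning
... | no c≢x = begin
  rank U c + 𝟙 (does (c ∉? U))
    ≡⟨ cong (_+ 𝟙 (does (c ∉? U))) (rank-∷ U x x∉U c) ⟩
  rank (x ∷ U) c + 𝟙 (x <ᵇ c) + 𝟙 (does (c ∉? U))
    ≡⟨ rearrange (rank (x ∷ U) c) _ _ ⟩
  rank (x ∷ U) c + 𝟙 (does (c ∉? U)) + 𝟙 (x <ᵇ c)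
    ≡⟨ cong₂ (λ a b → rank (x ∷ U) c + 𝟙 a + 𝟙 b)
             (does-⇔ (∉-∷⇔∉ U c≢x) (c ∉? x ∷ U) (c ∉? U)) (<ᵇ-suc (c≢x ∘ sym)) ⟨
  rank (x ∷ U) c + 𝟙 (does (c ∉? x ∷ U)) + 𝟙 (x <ᵇ suc c) ∎
  where
  open ≡-Reasoning
  rearrange : ∀ r a b → r + a + b ≡ r + b + a
  rearrange = solve-∀

rank-mono : ∀ U {c c′} → c ≤ c′ → rank U c ≤ rank U c′
rank-mono U {c} {c′} c≤c′ = begin
  rank U c                                           ≤⟨ m≤m+n _ _ ⟩
  rank U c + ∑[ k < c′ ∸ c ] 𝟙 (does (c + k ∉? U))   ≡⟨ ∑<-+ c (c′ ∸ c) _ ⟨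
  rank U (c + (c′ ∸ c))                              ≡⟨ cong (rank U) (m+[n∸m]≡n c≤c′) ⟩
  rank U c′                                          ∎
  where open ≤-Reasoning

rank-suc : ∀ U x → x ∉ U → rank U (suc x) ≡ suc (rank U x)
rank-suc U x x∉U = trans (cong (λ b → rank U x + 𝟙 b) (dec-true (x ∉? U) x∉U)) (+-comm (rank U x) 1)

<ᵇ-rank : ∀ U x a → x ∉ U → (x <ᵇ a) ≡ (rank U x <ᵇ rank U a)
<ᵇ-rank U x a x∉U with x <? a
... | yes x<a =
  trans (<ᵇ-true x<a) (sym (<ᵇ-true (subst (_≤ rank U a) (rank-suc U x x∉U) (rank-mono U x<a))))
... | no  x≮a = trans (<ᵇ-false x≮a) (sym (<ᵇ-false (≤⇒≯ (rank-mono U (≮⇒≥ x≮a)))))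

rank-∷-below : ∀ U x c → x ∉ U → x < c → rank U c ≡ suc (rank (x ∷ U) c)
rank-∷-below U x c x∉U x<c = begin
  rank U c                          ≡⟨ rank-∷ U x x∉U c ⟩
  rank (x ∷ U) c + 𝟙 (x <ᵇ c)       ≡⟨ cong (λ b → rank (x ∷ U) c + 𝟙 b) (<ᵇ-true x<c) ⟩
  rank (x ∷ U) c + 1                ≡⟨ +-comm _ 1 ⟩
  suc (rank (x ∷ U) c)              ∎
  where open ≡-Reasoning

rank-∷-self : ∀ U x → x ∉ U → rank (x ∷ U) x ≡ rank U x
rank-∷-self U x x∉U = sym (begin
  rank U x                          ≡⟨ rank-∷ U x x∉U x ⟩
  rank (x ∷ U) x + 𝟙 (x <ᵇ x)       ≡⟨ cong (λ b → rank (x ∷ U) x + 𝟙 b) (<ᵇ-false (n≮n x)) ⟩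
  rank (x ∷ U) x + 0                ≡⟨ +-identityʳ _ ⟩
  rank (x ∷ U) x                    ∎)
  where open ≡-Reasoning

∑<-rank : ∀ U (F : ℕ → ℕ) c → ∑[ x < c ] (𝟙 (does (x ∉? U)) * F (rank U x)) ≡ ∑< (rank U c) F
∑<-rank U F zero    = refl
∑<-rank U F (suc c) with does (c ∉? U)
... | true  = trans (cong₂ _+_ (∑<-rank U F c) (+-identityʳ _)) (cong (λ l → ∑< l F) (+-comm 1 (rank U c)))
... | false =
  trans (+-identityʳ _) (trans (∑<-rank U F c) (cong (λ l → ∑< l F) (sym (+-identityʳ (rank U c)))))

rank-[] : ∀ c → rank [] c ≡ c
rank-[] zero    = refl
rank-[] (suc c) = trans (cong (_+ 1) (rank-[] c)) (+-comm c 1)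

-- The words w of length n with distinct letters below d outside U such that a w has i
-- descents; in the recursion U holds the letters already placed and a is the last of them.
freshCount : ℕ → List ℕ → ℕ → ℕ → ℕ → ℕ
freshCount d U a n i =
  ∑[ w ∈ allWords d n ] 𝟙 (does (fresh? U (toList w)) ∧ (desL (a ∷ List.map toℕ (toList w)) ≡ᵇ i))

∑∈-delay : ∀ {A : Set} (ws : List A) (P : A → Bool) (D : A → ℕ) i →
          ∑[ w ∈ ws ] 𝟙 (P w ∧ (suc (D w) ≡ᵇ i)) ≡ delay (λ j → ∑[ w ∈ ws ] 𝟙 (P w ∧ (D w ≡ᵇ j))) i
∑∈-delay ws P D zero    = ∑∈-zero ws (λ w → cong 𝟙 (∧-zeroʳ (P w)))
∑∈-delay ws P D (suc i) = refl

freshCountAfter : ℕ → List ℕ → ℕ → ℕ → ℕ → ℕ → ℕ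
freshCountAfter d U a n i x =
  if x <ᵇ a then delay (freshCount d (x ∷ U) x n) i else freshCount d (x ∷ U) x n i

freshCount-suc : ∀ d U a n i →
                 freshCount d U a (suc n) i ≡ ∑[ x < d ] (𝟙 (does (x ∉? U)) * freshCountAfter d U a n i x)
freshCount-suc d U a n i = ∑∈-allWords-suc d n _ _ firstLetter
  where
  firstLetter : ∀ b → ∑[ w ∈ allWords d n ] 𝟙 (does (fresh? U (b ∷ toList w))
                                              ∧ (desL (a ∷ toℕ b ∷ List.map toℕ (toList w)) ≡ᵇ i))
                    ≡ 𝟙 (does (toℕ b ∉? U)) * freshCountAfter d U a n i (toℕ b)
  firstLetter b with does (toℕ b ∉? U)
  ... | false = ∑∈-zero (allWords d n) (λ _ → refl)
  ... | true with toℕ b <ᵇ a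
  ...   | false = sym (+-identityʳ _)
  ...   | true  = trans (∑∈-delay (allWords d n) (λ w → does (fresh? (toℕ b ∷ U) (toList w)))
                                  (λ w → desL (toℕ b ∷ List.map toℕ (toList w))) i)
                        (sym (+-identityʳ _))

A′-summand : ℕ → ℕ → ℕ → ℕ → ℕ
A′-summand n p i k = if k <ᵇ p then delay (A′ n k) i else A′ n k i

A′-suc-∑ : ∀ n p i → p ≤ suc n → A′ (suc n) p i ≡ ∑[ k < suc n ] A′-summand n p i k
A′-suc-∑ n p i p≤ = sym (begin
  ∑< (suc n) F                             ≡⟨ cong (λ l → ∑< l F) (m+[n∸m]≡n p≤) ⟨
  ∑< (p + (suc n ∸ p)) F                   ≡⟨ ∑<-+ p (suc n ∸ p) F ⟩
  ∑< p F + ∑[ k < suc n ∸ p ] F (p + k)    ≡⟨ cong₂ _+_ (∑<-cong p below) (∑<-cong (suc n ∸ p) notBelow) ⟩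
  A′ (suc n) p i                           ∎)
  where
  open ≡-Reasoning
  F : ℕ → ℕ
  F = A′-summand n p i
  below : ∀ k → k < p → F k ≡ delay (A′ n k) i
  below k k<p = cong (λ b → if b then delay (A′ n k) i else A′ n k i) (<ᵇ-true k<p)
  notBelow : ∀ k → k < suc n ∸ p → F (p + k) ≡ A′ n (p + k) i
  notBelow k _ = cong (λ b → if b then delay (A′ n (p + k)) i else A′ n (p + k) i)
                      (<ᵇ-false (≤⇒≯ (m≤m+n p k)))

-- Only the relative order of the letters matters: ranking the letters outside U turns the
-- words counted into the permutations of {0,…,n} starting with rank U a.
freshCount≡A′ : ∀ d n U a i → a ≤ d → rank U d ≡ n → freshCount d U a n i ≡ A′ n (rank U a) i
freshCount≡A′ d zero    U a zero    _   _     = refl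
freshCount≡A′ d zero    U a (suc i) _   _     = refl
freshCount≡A′ d (suc n) U a i       a≤d rank≡ = begin
  freshCount d U a (suc n) i                                    ≡⟨ freshCount-suc d U a n i ⟩
  ∑[ x < d ] (𝟙 (does (x ∉? U)) * freshCountAfter d U a n i x)  ≡⟨ ∑<-cong d afterLetter ⟩
  ∑[ x < d ] (𝟙 (does (x ∉? U)) * F (rank U x))                 ≡⟨ ∑<-rank U F d ⟩
  ∑< (rank U d) F                                               ≡⟨ cong (λ l → ∑< l F) rank≡ ⟩
  ∑< (suc n) F                                                  ≡⟨ A′-suc-∑ n p i p≤1+n ⟨
  A′ (suc n) p i                                                ∎
  where
  open ≡-Reasoning
  p : ℕ
  p = rank U a
  p≤1+n : p ≤ suc n
  p≤1+n = subst (p ≤_) rank≡ (rank-mono U a≤d)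
  F : ℕ → ℕ
  F = A′-summand n p i
  afterFresh : ∀ x → x < d → x ∉ U → freshCountAfter d U a n i x ≡ F (rank U x)
  afterFresh x x<d x∉U = trans
    (cong (λ b → if b then delay (freshCount d (x ∷ U) x n) i else freshCount d (x ∷ U) x n i)
          (<ᵇ-rank U x a x∉U))
    (cong₂ (λ u v → if rank U x <ᵇ p then u else v) (delay-cong i count) (count i))
    where
    rank-d : rank (x ∷ U) d ≡ n
    rank-d = suc-injective (trans (sym (rank-∷-below U x d x∉U x<d)) rank≡)
    count : ∀ j → freshCount d (x ∷ U) x n j ≡ A′ n (rank U x) j
    count j = trans (freshCount≡A′ d n (x ∷ U) x j (<⇒≤ x<d) rank-d)
                    (cong (λ r → A′ n r j) (rank-∷-self U x x∉U))
  afterLetter : ∀ x → x < d →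
                𝟙 (does (x ∉? U)) * freshCountAfter d U a n i x ≡ 𝟙 (does (x ∉? U)) * F (rank U x)
  afterLetter x x<d with x ∈? U
  ... | yes _   = refl
  ... | no  x∉U = cong (_+ 0) (afterFresh x x<d x∉U)

A≡A′ : ∀ n i q → q ≤ n → A (suc n) i (suc q) ≡ A′ n q i
A≡A′ n i q q≤n = begin
  A d i (suc q)
    ≡⟨ length-filter-filter isDesFirst isPerm (allWords d d) ⟩
  ∑[ v ∈ allWords d d ] 𝟙 (does (isPerm v) ∧ does (isDesFirst v))
    ≡⟨ ∑∈-allWords-suc d n _ _ firstLetter ⟩
  ∑[ x < d ] (𝟙 (x ≡ᵇ q) * freshCount d (x ∷ []) x n i)
    ≡⟨ ∑<-indicator q _ d (s≤s q≤n) ⟩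
  freshCount d (q ∷ []) q n i
    ≡⟨ freshCount≡A′ d n (q ∷ []) q i (m≤n⇒m≤1+n q≤n) rank-d ⟩
  A′ n (rank (q ∷ []) q) i
    ≡⟨ cong (λ r → A′ n r i) (trans (rank-∷-self [] q λ ()) (rank-[] q)) ⟩
  A′ n q i ∎
  where
  open ≡-Reasoning
  d : ℕ
  d = suc n
  isPerm : (v : Vec (Fin d) d) → Dec (Unique (toList v))
  isPerm v = UDec.unique? Fin._≟_ (toList v)
  isDesFirst : (v : Vec (Fin d) d) → Dec (des v ≡ i × first v ≡ suc q)
  isDesFirst v = (des v ≟ i) ×-dec (first v ≟ suc q)
  firstLetter : ∀ b → ∑[ w ∈ allWords d n ] 𝟙 (does (isPerm (b Vec.∷ w)) ∧ does (isDesFirst (b Vec.∷ w)))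
                    ≡ 𝟙 (toℕ b ≡ᵇ q) * freshCount d (toℕ b ∷ []) (toℕ b) n i
  firstLetter b with toℕ b ≡ᵇ q
  ... | false = ∑∈-zero (allWords d n) (λ w →
                  cong 𝟙 (trans (cong (does (isPerm (b Vec.∷ w)) ∧_) (∧-zeroʳ _)) (∧-zeroʳ _)))
  ... | true  = trans (∑∈-cong (allWords d n) (λ w →
                         cong 𝟙 (cong₂ _∧_ (does-unique≡fresh b (toList w)) (∧-identityʳ _))))
                      (sym (+-identityʳ _))
  rank-d : rank (q ∷ []) d ≡ n
  rank-d = suc-injective (trans (sym (rank-∷-below [] q d (λ ()) (s≤s q≤n))) (rank-[] d))

seqA≡A′ : ∀ n r i → r ≤ n → seqA (suc n) (r + i * suc n) ≡ A′ n (n ∸ r) i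
seqA≡A′ n r i r≤n = begin
  A d ((r + i * d) / d) (d ∸ (r + i * d) % d)   ≡⟨ cong₂ (λ x y → A d x (d ∸ y)) quotient remainder ⟩
  A d i (d ∸ r)                                 ≡⟨ cong (A d i) (+-∸-assoc 1 r≤n) ⟩
  A d i (suc (n ∸ r))                           ≡⟨ A≡A′ n i (n ∸ r) (m∸n≤m n r) ⟩
  A′ n (n ∸ r) i                                ∎
  where
  open ≡-Reasoning
  d : ℕ
  d = suc n
  remainder : (r + i * d) % d ≡ r
  remainder = trans ([m+kn]%n≡m%n r i d) (m<n⇒m%n≡m (s≤s r≤n))
  quotient : (r + i * d) / d ≡ i
  quotient = begin
    (r + i * d) / d      ≡⟨ +-distrib-/-∣ʳ r (n∣m*n i) ⟩
    r / d + i * d / d    ≡⟨ cong₂ _+_ (m<n⇒m/n≡0 (s≤s r≤n)) (m*n/n≡m i d) ⟩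
    i                    ∎

seqA-symmetric : ∀ n → Symmetric (n + n * suc n) (seqA (suc n))
seqA-symmetric n m m≤N = begin
  seqA d m                          ≡⟨ cong (seqA d) (m≡m%n+[m/n]*n m d) ⟩
  seqA d (r + i * d)                ≡⟨ seqA≡A′ n r i r≤n ⟩
  A′ n (n ∸ r) i                    ≡⟨ A′-sym n (n ∸ r) i (m∸n≤m n r) i≤n ⟩
  A′ n (n ∸ (n ∸ r)) (n ∸ i)        ≡⟨ seqA≡A′ n (n ∸ r) (n ∸ i) (m∸n≤m n r) ⟨
  seqA d ((n ∸ r) + (n ∸ i) * d)    ≡⟨ cong (seqA d) mirror ⟨
  seqA d (n + n * d ∸ m)            ∎
  where
  open ≡-Reasoning
  d r i : ℕ
  d = suc n
  r = m % d
  i = m / d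
  r≤n : r ≤ n
  r≤n = ≤-pred (m%n<n m d)
  i≤n : i ≤ n
  i≤n = ≤-pred (m<n*o⇒m/o<n {m} {d} {d} (s≤s m≤N))
  mirror : n + n * d ∸ m ≡ (n ∸ r) + (n ∸ i) * d
  mirror = m+n≡o⇒o∸m≡n m (begin
    m + ((n ∸ r) + (n ∸ i) * d)                ≡⟨ cong (_+ ((n ∸ r) + (n ∸ i) * d)) (m≡m%n+[m/n]*n m d) ⟩
    r + i * d + ((n ∸ r) + (n ∸ i) * d)        ≡⟨ rearrange r i (n ∸ r) (n ∸ i) d ⟩
    (r + (n ∸ r)) + (i + (n ∸ i)) * d          ≡⟨ cong₂ (λ x y → x + y * d) (m+[n∸m]≡n r≤n) (m+[n∸m]≡n i≤n) ⟩
    n + n * d                                  ∎)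
    where
    rearrange : ∀ r i a b d → r + i * d + (a + b * d) ≡ (r + a) + (i + b) * d
    rearrange = solve-∀

firstHalf-bounds : ∀ n r i → r ≤ n →
                   suc (r + i * suc (suc n)) + suc (r + i * suc (suc n)) ≤ suc n + suc n * suc (suc n) →
                   i + i ≤ suc n × (i + i ≡ suc n → i ≤ n ∸ r)
firstHalf-bounds n r i r≤n H = 2i≤1+n , middle
  where
  d : ℕ
  d = suc (suc n)
  H′ : (r + r + 2) + (i + i) * d ≤ suc n + suc n * d
  H′ = subst (_≤ suc n + suc n * d) (regroup r i d) H
    where
    regroup : ∀ r i d → suc (r + i * d) + suc (r + i * d) ≡ (r + r + 2) + (i + i) * d
    regroup = solve-∀
  2i≤1+n : i + i ≤ suc n
  2i≤1+n = ≤-pred (*-cancelʳ-< d (i + i) d (s≤s (m+n≤o⇒n≤o (r + r + 2) H′)))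
  middle : i + i ≡ suc n → i ≤ n ∸ r
  middle 2i≡ = m+n≤o⇒m≤o∸n i (≤-pred (subst₂ _≤_ (+-suc i r) 2i≡ (+-monoʳ-≤ i r<i)))
    where
    2r+2≤2i : r + r + 2 ≤ i + i
    2r+2≤2i = subst (r + r + 2 ≤_) (sym 2i≡)
                (+-cancelʳ-≤ (suc n * d) _ _ (subst (λ x → r + r + 2 + x * d ≤ suc n + suc n * d) 2i≡ H′))
    r<i : suc r ≤ i
    r<i = m+m≤n+n⇒m≤n (subst (_≤ i + i) (regroup r) 2r+2≤2i)
      where
      regroup : ∀ r → r + r + 2 ≡ suc r + suc r
      regroup = solve-∀

seqA-rises-at : ∀ n r i → r ≤ n → suc (r + i * suc n) + suc (r + i * suc n) ≤ n + n * suc n →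
                seqA (suc n) (r + i * suc n) ≤ seqA (suc n) (suc (r + i * suc n))
seqA-rises-at zero    r i _   ()
seqA-rises-at (suc n) r i r≤n H with m≤n⇒m<n∨m≡n r≤n
... | inj₂ refl = ≤-reflexive (begin-equality
  seqA (suc r) (r + i * suc r)       ≡⟨ seqA≡A′ r r i ≤-refl ⟩
  A′ r (r ∸ r) i                     ≡⟨ cong (λ x → A′ r x i) (n∸n≡0 r) ⟩
  A′ r 0 i                           ≡⟨ A′-first≡last n i ⟩
  A′ r r (suc i)                     ≡⟨ seqA≡A′ r 0 (suc i) z≤n ⟨
  seqA (suc r) (0 + suc i * suc r)   ∎)
  where open ≤-Reasoning
... | inj₁ (s≤s r≤n′) = begin
  seqA (suc (suc n)) (r + i * suc (suc n))          ≡⟨ seqA≡A′ (suc n) r i r≤n ⟩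
  A′ (suc n) (suc n ∸ r) i                          ≡⟨ cong (λ x → A′ (suc n) x i) (+-∸-assoc 1 r≤n′) ⟩
  A′ (suc n) (suc (n ∸ r)) i                        ≤⟨ A′-row-descends n (n ∸ r) i (m∸n≤m n r)
                                                         (A′-column-rises n (n ∸ r) i (m∸n≤m n r) 2i≤1+n middle) ⟩
  A′ (suc n) (n ∸ r) i                              ≡⟨ seqA≡A′ (suc n) (suc r) i (s≤s r≤n′) ⟨
  seqA (suc (suc n)) (suc r + i * suc (suc n))      ∎
  where
  open ≤-Reasoning
  2i≤1+n : i + i ≤ suc n
  2i≤1+n = proj₁ (firstHalf-bounds n r i r≤n′ H)
  middle : i + i ≡ suc n → i ≤ n ∸ r
  middle = proj₂ (firstHalf-bounds n r i r≤n′ H)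

seqA-rises-to-middle : ∀ n m → suc m + suc m ≤ n + n * suc n → seqA (suc n) m ≤ seqA (suc n) (suc m)
seqA-rises-to-middle n m H = subst (λ x → seqA d x ≤ seqA d (suc x)) (sym m≡)
  (seqA-rises-at n (m % d) (m / d) (≤-pred (m%n<n m d)) (subst (λ x → suc x + suc x ≤ n + n * d) m≡ H))
  where
  d : ℕ
  d = suc n
  m≡ : m ≡ m % d + m / d * d
  m≡ = m≡m%n+[m/n]*n m d

corollary4p10 : (n : ℕ) → let d = suc n in
                  Symmetric (d * d ∸ 1) (seqA d) × Unimodal (d * d ∸ 1) (seqA d)
corollary4p10 n =
  seqA-symmetric n , symmetric∧rising⇒unimodal _ (seqA (suc n)) (seqA-symmetric n) (seqA-rises-to-middle n)
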